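{- Let $G$ be a skew algebraic formula with sum-depth $\delta$, in which all gates have fan-in $2$ and the leaves are labelled by distinct variables. Then the polynomial computed by $G$ is a multilinear polynomial with at most $2^\delta$ monomials. Moreover, any variable labelling in $G$ either a $+$-leaf, or a $\times$-leaf whose sibling is a leaf, appears in exactly one monomial of this polynomial.
   Context: An algebraic formula is a rooted tree with edges directed towards the root; leaves are labelled by variables (or the constant $1$), edges are labelled by non-zero field constants, and internal nodes are labelled $+$ (computing the linear combination of its children with edge weights as coefficients) or $\times$ (computing the product of its children, in a fixed order in the non-commutative case). The sum-depth is the maximum number of $+$-gates on a leaf-to-root path. A formula is skew if every $\times$-gate has at most one child that is not a leaf. A leaf is a $+$-leaf if its parent is a $+$-gate, and a $\times$-leaf otherwise. -}

module Defs where

open import Level using (Level)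
open import Algebra.Bundles using (CommutativeRing)
open import Data.Nat as ℕ using (ℕ; zero; _⊔_)
open import Data.Bool using (Bool; true; false; if_then_else_)
import Data.Maybe
import Data.List
import Data.Product
open import Data.List using (List; []; _∷_; map)
open import Data.List.Properties using (≡-dec)
open import Data.List.Membership.Propositional using (_∈_)
open import Data.List.Relation.Unary.All using (All)
open import Data.Product using (_×_; _,_; Σ; ∃)
open import Relation.Nullary using (¬_; yes; no)
open import Relation.Binary.PropositionalEquality using (_≡_)

record Field (c ℓ : Level) : Set (Level.suc (c Level.⊔ ℓ)) where
  field
    commutativeRing : CommutativeRing c ℓ
  open CommutativeRing commutativeRing public
  field
    1≉0     : ¬ (1# ≈ 0#)
    inverse : ∀ x → ¬ (x ≈ 0#) → Σ Carrier λ y → (x * y) ≈ 1#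

module FormulaDefs {c ℓ : Level} (F : Field c ℓ) where
  open Field F

  Var : Set
  Var = ℕ

  -- Monomials in non-commuting variables: words over the variables.
  Monomial : Set
  Monomial = List Var

  -- A (non-commutative) polynomial, given by its coefficient function.
  -- (Only finitely supported ones arise from formulas.)
  Poly : Set c
  Poly = Monomial → Carrier

  -- Algebraic formulas: leaves are variables or the constant 1; every edge
  -- (from a child into its parent gate) carries a field constant.
  data Formula : Set c where
    var : Var → Formula
    one : Formula
    add : List (Carrier × Formula) → Formula
    mul : List (Carrier × Formula) → Formula

  zeroP : Poly
  zeroP _ = 0#

  monoP : Monomial → Poly
  monoP m w with ≡-dec ℕ._≟_ w m
  ... | yes _ = 1#
  ... | no  _ = 0#

  _+P_ : Poly → Poly → Poly
  (p +P q) w = p w + q w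

  scaleP : Carrier → Poly → Poly
  scaleP a p w = a * p w

  splits : Monomial → List (Monomial × Monomial)
  splits []      = ([] , []) ∷ []
  splits (x ∷ w) = ([] , x ∷ w) ∷ map (λ { (u , v) → (x ∷ u , v) }) (splits w)

  sumC : List Carrier → Carrier
  sumC []       = 0#
  sumC (a ∷ as) = a + sumC as

  _*P_ : Poly → Poly → Poly
  (p *P q) w = sumC (map (λ { (u , v) → p u * q v }) (splits w))

  mutual
    ⟦_⟧ : Formula → Poly
    ⟦ var x  ⟧ = monoP (x ∷ [])
    ⟦ one    ⟧ = monoP []
    ⟦ add cs ⟧ = ⟦sum cs ⟧
    ⟦ mul cs ⟧ = ⟦prod cs ⟧

    ⟦sum_⟧ : List (Carrier × Formula) → Poly
    ⟦sum [] ⟧           = zeroP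
    ⟦sum (a , f) ∷ cs ⟧ = scaleP a ⟦ f ⟧ +P ⟦sum cs ⟧

    ⟦prod_⟧ : List (Carrier × Formula) → Poly
    ⟦prod [] ⟧           = monoP []
    ⟦prod (a , f) ∷ cs ⟧ = scaleP a ⟦ f ⟧ *P ⟦prod cs ⟧

  mutual
    sumDepth : Formula → ℕ
    sumDepth (var _)  = 0
    sumDepth one      = 0
    sumDepth (add cs) = ℕ.suc (sumDepthL cs)
    sumDepth (mul cs) = sumDepthL cs

    sumDepthL : List (Carrier × Formula) → ℕ
    sumDepthL []            = 0
    sumDepthL ((_ , f) ∷ cs) = sumDepth f ⊔ sumDepthL cs

  data IsLeaf : Formula → Set c where
    var-leaf : ∀ x → IsLeaf (var x)
    one-leaf : IsLeaf one

  data AtMostOneNonLeaf : List (Carrier × Formula) → Set c where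
    none  : ∀ {cs} → All (λ e → IsLeaf (Data.Product.proj₂ e)) cs → AtMostOneNonLeaf cs
    here  : ∀ {a f cs} → All (λ e → IsLeaf (Data.Product.proj₂ e)) cs → AtMostOneNonLeaf ((a , f) ∷ cs)
    there : ∀ {a f cs} → IsLeaf f → AtMostOneNonLeaf cs → AtMostOneNonLeaf ((a , f) ∷ cs)

  data Skew : Formula → Set c where
    var : ∀ x → Skew (var x)
    one : Skew one
    add : ∀ {cs} → All (λ e → Skew (Data.Product.proj₂ e)) cs → Skew (add cs)
    mul : ∀ {cs} → AtMostOneNonLeaf cs → All (λ e → Skew (Data.Product.proj₂ e)) cs → Skew (mul cs)

  data FanIn2 : Formula → Set c where
    var : ∀ x → FanIn2 (var x)
    one : FanIn2 one
    add : ∀ {a f b g} → FanIn2 f → FanIn2 g → FanIn2 (add ((a , f) ∷ (b , g) ∷ []))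
    mul : ∀ {a f b g} → FanIn2 f → FanIn2 g → FanIn2 (mul ((a , f) ∷ (b , g) ∷ []))

  data NonZeroWeights : Formula → Set (c Level.⊔ ℓ) where
    var : ∀ x → NonZeroWeights (var x)
    one : NonZeroWeights one
    add : ∀ {cs} → All (λ e → ¬ (Data.Product.proj₁ e ≈ 0#) × NonZeroWeights (Data.Product.proj₂ e)) cs
          → NonZeroWeights (add cs)
    mul : ∀ {cs} → All (λ e → ¬ (Data.Product.proj₁ e ≈ 0#) × NonZeroWeights (Data.Product.proj₂ e)) cs
          → NonZeroWeights (mul cs)

  -- the list of leaf labels, left to right (nothing = the constant 1)
  mutual
    leafLabels : Formula → List (Data.Maybe.Maybe Var)
    leafLabels (var x)  = Data.Maybe.just x ∷ []
    leafLabels one      = Data.Maybe.nothing ∷ []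
    leafLabels (add cs) = leafLabelsL cs
    leafLabels (mul cs) = leafLabelsL cs

    leafLabelsL : List (Carrier × Formula) → List (Data.Maybe.Maybe Var)
    leafLabelsL []             = []
    leafLabelsL ((_ , f) ∷ cs) = leafLabels f Data.List.++ leafLabelsL cs

  -- "x labels a +-leaf, or a ×-leaf whose sibling is a leaf" (somewhere in G).
  -- For fan-in-2 gates, "the sibling is a leaf" is the same as "all children
  -- of the parent ×-gate are leaves".
  data SpecialVar : Formula → Var → Set c where
    plus-leaf  : ∀ {cs a x} → (a , var x) ∈ cs → SpecialVar (add cs) x
    times-leaf : ∀ {cs a x} → (a , var x) ∈ cs → All (λ e → IsLeaf (Data.Product.proj₂ e)) cs
                 → SpecialVar (mul cs) x
    in-add     : ∀ {cs a f x} → (a , f) ∈ cs → SpecialVar f x → SpecialVar (add cs) x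
    in-mul     : ∀ {cs a f x} → (a , f) ∈ cs → SpecialVar f x → SpecialVar (mul cs) x

  Occurs : Poly → Monomial → Set ℓ
  Occurs p w = ¬ (p w ≈ 0#)

{-# OPTIONS --safe #-}
module Submission where

open import Defs
open import Level using (Level) renaming (_⊔_ to _⊔ˡ_)
open import Function using (_∘_)
open import Data.Nat as ℕ using (ℕ; _≤_; _^_; _⊔_)
open import Data.Nat.Properties using (≤-refl; ≤-reflexive; ≤-trans; +-mono-≤; ^-monoʳ-≤; m≤m⊔n; m≤n⊔m; m≤m+n; ⊔-identityʳ)
open import Data.List using (List; []; _∷_; _++_; map; _∷ʳ_; length; initLast; _∷ʳ′_)
open import Data.List.Properties using (≡-dec; ∷-injective; map-∘; ++-identityʳ; length-++; length-map)
open import Data.List.Membership.Propositional using (_∈_; _∉_)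
open import Data.List.Membership.Propositional.Properties using (∈-map⁺; ∈-map⁻; ∈-++⁺ˡ; ∈-++⁺ʳ; ∈-++⁻)
open import Data.List.Membership.DecPropositional (≡-dec ℕ._≟_) using (_∈?_)
open import Data.List.Relation.Binary.Disjoint.Propositional using (Disjoint)
open import Data.List.Relation.Unary.All using (All; []; _∷_; lookup; tabulate)
import Data.List.Relation.Unary.All.Properties as All
open import Data.List.Relation.Unary.AllPairs using ([]; _∷_)
open import Data.List.Relation.Unary.Any using (here; there)
open import Data.List.Relation.Unary.Unique.Propositional using (Unique)
import Data.List.Relation.Unary.Unique.Propositional.Properties as Unique
open import Data.Maybe using (just; Is-just)
open import Data.Product using (_×_; _,_; Σ; ∃!; proj₁; proj₂)
open import Data.Sum using (_⊎_; inj₁; inj₂)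
open import Relation.Binary.PropositionalEquality as ≡ using (_≡_; _≢_)
open import Relation.Nullary using (¬_; Dec; yes; no; contradiction)
open import Relation.Nullary.Decidable using (decidable-stable)

-- Skewness and fan-in 2 force every ×-gate to multiply a subformula by a single
-- variable y, on the left or on the right; as y does not occur below, this maps the
-- support injectively by w ↦ y w or w ↦ w y, keeping its size and keeping monomials
-- multilinear. A +-gate combines, with non-zero weights, two subformulas on disjoint
-- sets of variables, so their supports are disjoint and nothing cancels: the support
-- is their union, and its size at most doubles. A +-leaf x contributes the monomial x
-- and a ×-gate on two leaves x, y the monomial x y; higher up, the monomial containing
-- x is only ever extended, and no other monomial can acquire x.

Unique-++⁻ : ∀ {A : Set} (xs : List A) {ys} → Unique (xs ++ ys) → Unique xs × Unique ys × Disjoint xs ys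
Unique-++⁻ []       u          = [] , u , λ ()
Unique-++⁻ (x ∷ xs) (x∉ ∷ u) with Unique-++⁻ xs u
... | uxs , uys , xs#ys = All.++⁻ˡ xs x∉ ∷ uxs , uys , λ
  { (here ≡.refl , v∈ys)  → lookup (All.++⁻ʳ xs x∉) v∈ys ≡.refl
  ; (there v∈xs , v∈ys) → xs#ys (v∈xs , v∈ys)
  }

∷ʳ≢[] : ∀ {A : Set} (u : List A) z → u ∷ʳ z ≢ []
∷ʳ≢[] []      z ()
∷ʳ≢[] (_ ∷ _) z ()

2^m+2^n≤2^[1+m⊔n] : ∀ m n → 2 ^ m ℕ.+ 2 ^ n ≤ 2 ^ ℕ.suc (m ⊔ n)
2^m+2^n≤2^[1+m⊔n] m n = +-mono-≤ (^-monoʳ-≤ 2 (m≤m⊔n m n)) (≤-trans (^-monoʳ-≤ 2 (m≤n⊔m m n)) (m≤m+n _ 0))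

module _ {A : Set} where

  UniqueListWith : A → List (List A) → Set
  UniqueListWith x S = ∃! _≡_ λ w → w ∈ S × x ∈ w

  uniqueListWith-singleton : ∀ {x w} → x ∈ w → UniqueListWith x (w ∷ [])
  uniqueListWith-singleton x∈w = _ , (here ≡.refl , x∈w) , λ { (here ≡.refl , _) → ≡.refl }

  uniqueListWith-++ˡ : ∀ {x S T} → UniqueListWith x S → (∀ {w} → w ∈ T → x ∉ w) → UniqueListWith x (S ++ T)
  uniqueListWith-++ˡ {x} {S} {T} (w , (w∈S , x∈w) , only) x∉T = w , (∈-++⁺ˡ w∈S , x∈w) , only′
    where
    only′ : ∀ {w′} → w′ ∈ S ++ T × x ∈ w′ → w ≡ w′
    only′ (w′∈S++T , x∈w′) with ∈-++⁻ S w′∈S++T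
    ... | inj₁ w′∈S = only (w′∈S , x∈w′)
    ... | inj₂ w′∈T = contradiction x∈w′ (x∉T w′∈T)

  uniqueListWith-++ʳ : ∀ {x S T} → UniqueListWith x T → (∀ {w} → w ∈ S → x ∉ w) → UniqueListWith x (S ++ T)
  uniqueListWith-++ʳ {x} {S} {T} (w , (w∈T , x∈w) , only) x∉S = w , (∈-++⁺ʳ S w∈T , x∈w) , only′
    where
    only′ : ∀ {w′} → w′ ∈ S ++ T × x ∈ w′ → w ≡ w′
    only′ (w′∈S++T , x∈w′) with ∈-++⁻ S w′∈S++T
    ... | inj₁ w′∈S = contradiction x∈w′ (x∉S w′∈S)
    ... | inj₂ w′∈T = only (w′∈T , x∈w′)

  uniqueListWith-map : ∀ {x S} (f : List A → List A) → (∀ {u} → x ∈ u → x ∈ f u) →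
                       (∀ {u} → u ∈ S → x ∈ f u → x ∈ u) → UniqueListWith x S → UniqueListWith x (map f S)
  uniqueListWith-map {x} {S} f ∈-f ∈-f⁻ (w , (w∈S , x∈w) , only) = f w , (∈-map⁺ f w∈S , ∈-f x∈w) , only′
    where
    only′ : ∀ {w′} → w′ ∈ map f S × x ∈ w′ → f w ≡ w′
    only′ (w′∈fS , x∈w′) with ∈-map⁻ f w′∈fS
    ... | u , u∈S , ≡.refl = ≡.cong f (only (u∈S , ∈-f⁻ u∈S x∈w′))

module PolynomialProperties {c ℓ : Level} (F : Field c ℓ) where
  open Field F
  open FormulaDefs F
  open import Algebra.Properties.CommutativeSemigroup *-commutativeSemigroup using (x∙yz≈y∙xz)
  open import Relation.Binary.Reasoning.Setoid setoid

  infix 4 _≐_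
  _≐_ : Poly → Poly → Set ℓ
  p ≐ q = ∀ w → p w ≈ q w

  ∂ : Var → Poly → Poly
  ∂ x p w = p (x ∷ w)

  *-≉0 : ∀ {x y} → x ≉ 0# → y ≉ 0# → x * y ≉ 0#
  *-≉0 {x} {y} x≉0 y≉0 xy≈0 with inverse x x≉0
  ... | x⁻¹ , xx⁻¹≈1 = y≉0 (begin
    y               ≈⟨ *-identityˡ y ⟨
    1# * y          ≈⟨ *-cong (trans (sym xx⁻¹≈1) (*-comm x x⁻¹)) refl ⟩
    (x⁻¹ * x) * y   ≈⟨ *-assoc x⁻¹ x y ⟩
    x⁻¹ * (x * y)   ≈⟨ *-cong refl xy≈0 ⟩
    x⁻¹ * 0#        ≈⟨ zeroʳ x⁻¹ ⟩
    0#              ∎)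

  monoP-≡ : ∀ m → monoP m m ≡ 1#
  monoP-≡ m with ≡-dec ℕ._≟_ m m
  ... | yes _   = ≡.refl
  ... | no m≢m = contradiction ≡.refl m≢m

  monoP-≢ : ∀ m w → w ≢ m → monoP m w ≡ 0#
  monoP-≢ m w w≢m with ≡-dec ℕ._≟_ w m
  ... | yes w≡m = contradiction w≡m w≢m
  ... | no _    = ≡.refl

  sumC-map-cong : ∀ {A : Set} {h h′ : A → Carrier} → (∀ s → h s ≈ h′ s) →
                  ∀ xs → sumC (map h xs) ≈ sumC (map h′ xs)
  sumC-map-cong h≈h′ []       = refl
  sumC-map-cong h≈h′ (s ∷ xs) = +-cong (h≈h′ s) (sumC-map-cong h≈h′ xs)

  sumC-map-*ˡ : ∀ {A : Set} a (h : A → Carrier) xs → sumC (map (λ s → a * h s) xs) ≈ a * sumC (map h xs)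
  sumC-map-*ˡ a h []       = sym (zeroʳ a)
  sumC-map-*ˡ a h (s ∷ xs) = trans (+-cong refl (sumC-map-*ˡ a h xs)) (sym (distribˡ a (h s) _))

  *P-[] : ∀ p q → (p *P q) [] ≈ p [] * q []
  *P-[] p q = +-identityʳ _

  *P-∷ : ∀ p q x w → (p *P q) (x ∷ w) ≡ p [] * q (x ∷ w) + (∂ x p *P q) w
  *P-∷ p q x w = ≡.cong (λ ts → p [] * q (x ∷ w) + sumC ts) (≡.sym (map-∘ (splits w)))

  *P-cong : ∀ {p p′ q q′} → p ≐ p′ → q ≐ q′ → p *P q ≐ p′ *P q′
  *P-cong p≐p′ q≐q′ w = sumC-map-cong (λ (u , v) → *-cong (p≐p′ u) (q≐q′ v)) (splits w)

  *P-scaleˡ : ∀ a p q → scaleP a p *P q ≐ scaleP a (p *P q)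
  *P-scaleˡ a p q w = trans (sumC-map-cong (λ (u , v) → *-assoc a (p u) (q v)) (splits w))
                            (sumC-map-*ˡ a (λ (u , v) → p u * q v) (splits w))

  *P-scaleʳ : ∀ b p q → p *P scaleP b q ≐ scaleP b (p *P q)
  *P-scaleʳ b p q w = trans (sumC-map-cong (λ (u , v) → x∙yz≈y∙xz (p u) b (q v)) (splits w))
                            (sumC-map-*ˡ b (λ (u , v) → p u * q v) (splits w))

  *P-zeroˡ : ∀ q → zeroP *P q ≐ zeroP
  *P-zeroˡ q w = begin
    (zeroP *P q) w             ≈⟨ *P-cong (λ _ → sym (zeroˡ 0#)) (λ _ → refl) w ⟩
    (scaleP 0# zeroP *P q) w   ≈⟨ *P-scaleˡ 0# zeroP q w ⟩
    0# * (zeroP *P q) w        ≈⟨ zeroˡ _ ⟩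
    0#                         ∎

  *P-identityˡ : ∀ p → monoP [] *P p ≐ p
  *P-identityˡ p []      = begin
    (monoP [] *P p) []     ≈⟨ *P-[] (monoP []) p ⟩
    monoP [] [] * p []     ≡⟨ ≡.cong (_* p []) (monoP-≡ []) ⟩
    1# * p []              ≈⟨ *-identityˡ _ ⟩
    p []                   ∎
  *P-identityˡ p (x ∷ w) = begin
    (monoP [] *P p) (x ∷ w)                            ≡⟨ *P-∷ (monoP []) p x w ⟩
    monoP [] [] * p (x ∷ w) + (∂ x (monoP []) *P p) w  ≈⟨ +-cong (*-cong (reflexive (monoP-≡ [])) refl) ∂x1*p≈0 ⟩
    1# * p (x ∷ w) + 0#                                ≈⟨ +-identityʳ _ ⟩
    1# * p (x ∷ w)                                     ≈⟨ *-identityˡ _ ⟩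
    p (x ∷ w)                                          ∎
    where
    ∂x1*p≈0 : (∂ x (monoP []) *P p) w ≈ 0#
    ∂x1*p≈0 = trans (*P-cong (λ u → reflexive (monoP-≢ [] (x ∷ u) λ ())) (λ _ → refl) w) (*P-zeroˡ p w)

  *P-identityʳ : ∀ p → p *P monoP [] ≐ p
  *P-identityʳ p []      = begin
    (p *P monoP []) []     ≈⟨ *P-[] p (monoP []) ⟩
    p [] * monoP [] []     ≡⟨ ≡.cong (p [] *_) (monoP-≡ []) ⟩
    p [] * 1#              ≈⟨ *-identityʳ _ ⟩
    p []                   ∎
  *P-identityʳ p (x ∷ w) = begin
    (p *P monoP []) (x ∷ w)                            ≡⟨ *P-∷ p (monoP []) x w ⟩
    p [] * monoP [] (x ∷ w) + (∂ x p *P monoP []) w    ≈⟨ +-cong (*-cong refl (reflexive (monoP-≢ [] (x ∷ w) λ ()))) (*P-identityʳ (∂ x p) w) ⟩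
    p [] * 0# + p (x ∷ w)                              ≈⟨ +-cong (zeroʳ _) refl ⟩
    0# + p (x ∷ w)                                     ≈⟨ +-identityˡ _ ⟩
    p (x ∷ w)                                          ∎

  *P-var-∷ʳ : ∀ p y u z → (p *P monoP (y ∷ [])) (u ∷ʳ z) ≈ p u * monoP (y ∷ []) (z ∷ [])
  *P-var-∷ʳ p y []      z = begin
    (p *P monoP (y ∷ [])) (z ∷ [])                                  ≡⟨ *P-∷ p (monoP (y ∷ [])) z [] ⟩
    p [] * monoP (y ∷ []) (z ∷ []) + (∂ z p *P monoP (y ∷ [])) []  ≈⟨ +-cong refl (*P-[] (∂ z p) (monoP (y ∷ []))) ⟩
    p [] * monoP (y ∷ []) (z ∷ []) + p (z ∷ []) * monoP (y ∷ []) []  ≈⟨ +-cong refl (*-cong refl (reflexive (monoP-≢ (y ∷ []) [] λ ()))) ⟩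
    p [] * monoP (y ∷ []) (z ∷ []) + p (z ∷ []) * 0#                ≈⟨ +-cong refl (zeroʳ _) ⟩
    p [] * monoP (y ∷ []) (z ∷ []) + 0#                             ≈⟨ +-identityʳ _ ⟩
    p [] * monoP (y ∷ []) (z ∷ [])                                  ∎
  *P-var-∷ʳ p y (x ∷ u) z = begin
    (p *P monoP (y ∷ [])) (x ∷ u ∷ʳ z)                                          ≡⟨ *P-∷ p (monoP (y ∷ [])) x (u ∷ʳ z) ⟩
    p [] * monoP (y ∷ []) (x ∷ u ∷ʳ z) + (∂ x p *P monoP (y ∷ [])) (u ∷ʳ z)   ≈⟨ +-cong (*-cong refl too-long) (*P-var-∷ʳ (∂ x p) y u z) ⟩
    p [] * 0# + p (x ∷ u) * monoP (y ∷ []) (z ∷ [])                             ≈⟨ +-cong (zeroʳ _) refl ⟩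
    0# + p (x ∷ u) * monoP (y ∷ []) (z ∷ [])                                    ≈⟨ +-identityˡ _ ⟩
    p (x ∷ u) * monoP (y ∷ []) (z ∷ [])                                         ∎
    where
    too-long : monoP (y ∷ []) (x ∷ u ∷ʳ z) ≈ 0#
    too-long = reflexive (monoP-≢ (y ∷ []) (x ∷ u ∷ʳ z) (∷ʳ≢[] u z ∘ proj₂ ∘ ∷-injective))

  var-*P-∷ : ∀ p y z v → (monoP (y ∷ []) *P p) (z ∷ v) ≈ monoP (y ∷ []) (z ∷ []) * p v
  var-*P-∷ p y z v = begin
    (monoP (y ∷ []) *P p) (z ∷ v)                                      ≡⟨ *P-∷ (monoP (y ∷ [])) p z v ⟩
    monoP (y ∷ []) [] * p (z ∷ v) + (∂ z (monoP (y ∷ [])) *P p) v      ≈⟨ +-cong (*-cong [y]-at-[] refl) (*P-cong ∂zy≐k·1 (λ _ → refl) v) ⟩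
    0# * p (z ∷ v) + (scaleP k (monoP []) *P p) v                       ≈⟨ +-cong (zeroˡ _) (*P-scaleˡ k (monoP []) p v) ⟩
    0# + k * (monoP [] *P p) v                                          ≈⟨ +-identityˡ _ ⟩
    k * (monoP [] *P p) v                                               ≈⟨ *-cong refl (*P-identityˡ p v) ⟩
    k * p v                                                             ∎
    where
    k : Carrier
    k = monoP (y ∷ []) (z ∷ [])
    [y]-at-[] : monoP (y ∷ []) [] ≈ 0#
    [y]-at-[] = reflexive (monoP-≢ (y ∷ []) [] λ ())
    ∂zy≐k·1 : ∂ z (monoP (y ∷ [])) ≐ scaleP k (monoP [])
    ∂zy≐k·1 []      = trans (sym (*-identityʳ k)) (*-cong refl (reflexive (≡.sym (monoP-≡ []))))
    ∂zy≐k·1 (x ∷ u) = begin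
      monoP (y ∷ []) (z ∷ x ∷ u)   ≡⟨ monoP-≢ (y ∷ []) (z ∷ x ∷ u) (λ ()) ⟩
      0#                           ≈⟨ zeroʳ k ⟨
      k * 0#                       ≡⟨ ≡.cong (k *_) (monoP-≢ [] (x ∷ u) λ ()) ⟨
      k * monoP [] (x ∷ u)         ∎

  record IsSupport (p : Poly) (S : List Monomial) : Set ℓ where
    field
      outside : ∀ {w} → w ∉ S → p w ≈ 0#
      inside  : ∀ {w} → w ∈ S → Occurs p w

    occurs⇒∈ : ∀ {w} → Occurs p w → w ∈ S
    occurs⇒∈ {w} occ = decidable-stable (w ∈? S) (occ ∘ outside)

  open IsSupport

  isSupport-resp : ∀ {p q S} → p ≐ q → IsSupport p S → IsSupport q S
  isSupport-resp p≐q supp = record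
    { outside = λ w∉S → trans (sym (p≐q _)) (outside supp w∉S)
    ; inside  = λ w∈S qw≈0 → inside supp w∈S (trans (p≐q _) qw≈0)
    }

  isSupport-monoP : ∀ m → IsSupport (monoP m) (m ∷ [])
  isSupport-monoP m = record
    { outside = λ {w} w∉[m] → reflexive (monoP-≢ m w (w∉[m] ∘ here))
    ; inside  = λ { (here ≡.refl) 1≈0 → 1≉0 (trans (reflexive (≡.sym (monoP-≡ m))) 1≈0) }
    }

  isSupport-scaleP : ∀ {a p S} → a ≉ 0# → IsSupport p S → IsSupport (scaleP a p) S
  isSupport-scaleP {a} a≉0 supp = record
    { outside = λ w∉S → trans (*-cong refl (outside supp w∉S)) (zeroʳ a)
    ; inside  = λ w∈S → *-≉0 a≉0 (inside supp w∈S)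
    }

  isSupport-+P : ∀ {p q S T} → Disjoint S T → IsSupport p S → IsSupport q T → IsSupport (p +P q) (S ++ T)
  isSupport-+P {p} {q} {S} {T} S#T suppS suppT = record
    { outside = λ w∉S++T → trans (+-cong (outside suppS (w∉S++T ∘ ∈-++⁺ˡ)) (outside suppT (w∉S++T ∘ ∈-++⁺ʳ S)))
                                 (+-identityʳ 0#)
    ; inside  = λ w∈S++T → inside-++ (∈-++⁻ S w∈S++T)
    }
    where
    inside-++ : ∀ {w} → w ∈ S ⊎ w ∈ T → Occurs (p +P q) w
    inside-++ (inj₁ w∈S) pw+qw≈0 = inside suppS w∈S (begin
      p _         ≈⟨ +-identityʳ _ ⟨
      p _ + 0#    ≈⟨ +-cong refl (outside suppT (λ w∈T → S#T (w∈S , w∈T))) ⟨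
      p _ + q _   ≈⟨ pw+qw≈0 ⟩
      0#          ∎)
    inside-++ (inj₂ w∈T) pw+qw≈0 = inside suppT w∈T (begin
      q _         ≈⟨ +-identityˡ _ ⟨
      0# + q _    ≈⟨ +-cong (outside suppS (λ w∈S → S#T (w∈S , w∈T))) refl ⟨
      p _ + q _   ≈⟨ pw+qw≈0 ⟩
      0#          ∎)

  isSupport-*P-var : ∀ {p S} y → IsSupport p S → IsSupport (p *P monoP (y ∷ [])) (map (_∷ʳ y) S)
  isSupport-*P-var {p} {S} y supp = record { outside = outside′ ; inside = inside′ }
    where
    m : Poly
    m = monoP (y ∷ [])
    outside′ : ∀ {w} → w ∉ map (_∷ʳ y) S → (p *P m) w ≈ 0#
    outside′ {w} w∉ with initLast w
    ... | [] = trans (*P-[] p m) (trans (*-cong refl (reflexive (monoP-≢ (y ∷ []) [] λ ()))) (zeroʳ _))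
    ... | u ∷ʳ′ z with z ℕ.≟ y
    ...   | yes ≡.refl = trans (*P-var-∷ʳ p y u z) (trans (*-cong (outside supp (w∉ ∘ ∈-map⁺ (_∷ʳ y))) refl) (zeroˡ _))
    ...   | no z≢y     = trans (*P-var-∷ʳ p y u z)
                               (trans (*-cong refl (reflexive (monoP-≢ (y ∷ []) (z ∷ []) (z≢y ∘ proj₁ ∘ ∷-injective)))) (zeroʳ _))
    inside′ : ∀ {w} → w ∈ map (_∷ʳ y) S → Occurs (p *P m) w
    inside′ w∈ with ∈-map⁻ (_∷ʳ y) w∈
    ... | u , u∈S , ≡.refl = λ pu·1≈0 → inside supp u∈S (begin
      p u                     ≈⟨ *-identityʳ (p u) ⟨
      p u * 1#                ≡⟨ ≡.cong (p u *_) (monoP-≡ (y ∷ [])) ⟨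
      p u * m (y ∷ [])        ≈⟨ *P-var-∷ʳ p y u y ⟨
      (p *P m) (u ∷ʳ y)       ≈⟨ pu·1≈0 ⟩
      0#                      ∎)

  isSupport-var-*P : ∀ {p S} y → IsSupport p S → IsSupport (monoP (y ∷ []) *P p) (map (y ∷_) S)
  isSupport-var-*P {p} {S} y supp = record { outside = outside′ ; inside = inside′ }
    where
    m : Poly
    m = monoP (y ∷ [])
    outside′ : ∀ {w} → w ∉ map (y ∷_) S → (m *P p) w ≈ 0#
    outside′ {[]}    w∉ = trans (*P-[] m p) (trans (*-cong (reflexive (monoP-≢ (y ∷ []) [] λ ())) refl) (zeroˡ _))
    outside′ {z ∷ v} w∉ with z ℕ.≟ y
    ... | yes ≡.refl = trans (var-*P-∷ p y z v) (trans (*-cong refl (outside supp (w∉ ∘ ∈-map⁺ (y ∷_)))) (zeroʳ _))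
    ... | no z≢y     = trans (var-*P-∷ p y z v)
                             (trans (*-cong (reflexive (monoP-≢ (y ∷ []) (z ∷ []) (z≢y ∘ proj₁ ∘ ∷-injective))) refl) (zeroˡ _))
    inside′ : ∀ {w} → w ∈ map (y ∷_) S → Occurs (m *P p) w
    inside′ w∈ with ∈-map⁻ (y ∷_) w∈
    ... | v , v∈S , ≡.refl = λ 1·pv≈0 → inside supp v∈S (begin
      p v                     ≈⟨ *-identityˡ (p v) ⟨
      1# * p v                ≡⟨ ≡.cong (_* p v) (monoP-≡ (y ∷ [])) ⟨
      m (y ∷ []) * p v        ≈⟨ var-*P-∷ p y y v ⟨
      (m *P p) (y ∷ v)        ≈⟨ 1·pv≈0 ⟩
      0#                      ∎)

module ReadOnceSkewFormulas {c ℓ : Level} (F : Field c ℓ) where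
  open Field F
  open FormulaDefs F
  open PolynomialProperties F
  open import Relation.Binary.Reasoning.Setoid setoid

  -- A ×-gate whose two children are variables is a mul-var.
  data ReadOnceSkew : Formula → Set (c ⊔ˡ ℓ) where
    var     : ∀ x → ReadOnceSkew (var x)
    add     : ∀ {a f b g} → a ≉ 0# → b ≉ 0# → ReadOnceSkew f → ReadOnceSkew g →
              Disjoint (leafLabels f) (leafLabels g) → ReadOnceSkew (add ((a , f) ∷ (b , g) ∷ []))
    mul-var : ∀ {a f b} y → a ≉ 0# → b ≉ 0# → ReadOnceSkew f → just y ∉ leafLabels f →
              ReadOnceSkew (mul ((a , f) ∷ (b , var y) ∷ []))
    var-mul : ∀ {a b g} y → a ≉ 0# → b ≉ 0# → ReadOnceSkew g → ¬ IsLeaf g → just y ∉ leafLabels g →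
              ReadOnceSkew (mul ((a , var y) ∷ (b , g) ∷ []))

  isLeaf? : ∀ f → Dec (IsLeaf f)
  isLeaf? (var x) = yes (var-leaf x)
  isLeaf? one     = yes one-leaf
  isLeaf? (add _) = no λ ()
  isLeaf? (mul _) = no λ ()

  leftIsLeaf : ∀ {a f b g} → AtMostOneNonLeaf ((a , f) ∷ (b , g) ∷ []) → ¬ IsLeaf g → IsLeaf f
  leftIsLeaf (none (f-leaf ∷ _)) g∉leaf = f-leaf
  leftIsLeaf (here (g-leaf ∷ [])) g∉leaf = contradiction g-leaf g∉leaf
  leftIsLeaf (there f-leaf _)    g∉leaf = f-leaf

  splitLeaves : ∀ f g → let fg = leafLabels f ++ leafLabels g ++ [] in
    All Is-just fg → Unique fg →
    (All Is-just (leafLabels f) × Unique (leafLabels f)) × (All Is-just (leafLabels g) × Unique (leafLabels g))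
    × Disjoint (leafLabels f) (leafLabels g)
  splitLeaves f g js us with All.++⁻ (leafLabels f) js | Unique-++⁻ (leafLabels f) us
  ... | jsf , jsg | uf , ug , f#g rewrite ++-identityʳ (leafLabels g) = (jsf , uf) , (jsg , ug) , f#g

  readOnceSkew : ∀ {G} → NonZeroWeights G → Skew G → FanIn2 G →
                 All Is-just (leafLabels G) → Unique (leafLabels G) → ReadOnceSkew G
  readOnceSkew _ _ (var x) _ _ = var x
  readOnceSkew _ _ one (() ∷ []) _
  readOnceSkew (add ((a≉0 , nzf) ∷ (b≉0 , nzg) ∷ [])) (add (skf ∷ skg ∷ [])) (add {f = f} {g = g} fif fig) js us
    with splitLeaves f g js us
  ... | (jsf , uf) , (jsg , ug) , f#g =
    add a≉0 b≉0 (readOnceSkew nzf skf fif jsf uf) (readOnceSkew nzg skg fig jsg ug) f#g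
  readOnceSkew (mul ((a≉0 , nzf) ∷ (b≉0 , nzg) ∷ [])) (mul amo (skf ∷ skg ∷ [])) (mul {f = f} {g = g} fif fig) js us
    with splitLeaves f g js us | isLeaf? g
  ... | _ , (() ∷ [] , _) , _        | yes one-leaf
  ... | (jsf , uf) , _ , f#g         | yes (var-leaf y) =
    mul-var y a≉0 b≉0 (readOnceSkew nzf skf fif jsf uf) (λ y∈f → f#g (y∈f , here ≡.refl))
  ... | (jsf , uf) , (jsg , ug) , f#g | no g∉leaf with leftIsLeaf amo g∉leaf | jsf
  ...   | one-leaf   | () ∷ []
  ...   | var-leaf y | _ = var-mul y a≉0 b≉0 (readOnceSkew nzg skg fig jsg ug) g∉leaf (λ y∈g → f#g (here ≡.refl , y∈g))

  ⟦add₂⟧ : ∀ a f b g → ⟦ add ((a , f) ∷ (b , g) ∷ []) ⟧ ≐ scaleP a ⟦ f ⟧ +P scaleP b ⟦ g ⟧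
  ⟦add₂⟧ a f b g w = +-cong refl (+-identityʳ _)

  ⟦mul₂⟧ : ∀ a f b g → ⟦ mul ((a , f) ∷ (b , g) ∷ []) ⟧ ≐ scaleP a (scaleP b (⟦ f ⟧ *P ⟦ g ⟧))
  ⟦mul₂⟧ a f b g w = begin
    (scaleP a ⟦ f ⟧ *P (scaleP b ⟦ g ⟧ *P monoP [])) w   ≈⟨ *P-cong (λ _ → refl) (*P-identityʳ (scaleP b ⟦ g ⟧)) w ⟩
    (scaleP a ⟦ f ⟧ *P scaleP b ⟦ g ⟧) w                 ≈⟨ *P-scaleˡ a ⟦ f ⟧ (scaleP b ⟦ g ⟧) w ⟩
    a * (⟦ f ⟧ *P scaleP b ⟦ g ⟧) w                      ≈⟨ *-cong refl (*P-scaleʳ b ⟦ f ⟧ ⟦ g ⟧ w) ⟩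
    a * (b * (⟦ f ⟧ *P ⟦ g ⟧) w)                         ∎

  monomials : ∀ {G} → ReadOnceSkew G → List Monomial
  monomials (var x)               = (x ∷ []) ∷ []
  monomials (add _ _ s t _)       = monomials s ++ monomials t
  monomials (mul-var y _ _ s _)   = map (_∷ʳ y) (monomials s)
  monomials (var-mul y _ _ t _ _) = map (y ∷_) (monomials t)

  ∈-monomials⇒leaf : ∀ {G} (t : ReadOnceSkew G) {w x} → w ∈ monomials t → x ∈ w → just x ∈ leafLabels G
  ∈-monomials⇒leaf (var x) (here ≡.refl) (here ≡.refl) = here ≡.refl
  ∈-monomials⇒leaf (add {f = f} _ _ s t _) w∈ x∈w with ∈-++⁻ (monomials s) w∈
  ... | inj₁ w∈s = ∈-++⁺ˡ (∈-monomials⇒leaf s w∈s x∈w)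
  ... | inj₂ w∈t = ∈-++⁺ʳ (leafLabels f) (∈-++⁺ˡ (∈-monomials⇒leaf t w∈t x∈w))
  ∈-monomials⇒leaf (mul-var {f = f} y _ _ s _) w∈ x∈w with ∈-map⁻ (_∷ʳ y) w∈
  ... | u , u∈s , ≡.refl with ∈-++⁻ u x∈w
  ...   | inj₁ x∈u          = ∈-++⁺ˡ (∈-monomials⇒leaf s u∈s x∈u)
  ...   | inj₂ (here ≡.refl) = ∈-++⁺ʳ (leafLabels f) (here ≡.refl)
  ∈-monomials⇒leaf (var-mul y _ _ t _ _) w∈ x∈w with ∈-map⁻ (y ∷_) w∈
  ... | v , v∈t , ≡.refl with x∈w
  ...   | here ≡.refl = here ≡.refl
  ...   | there x∈v   = there (∈-++⁺ˡ (∈-monomials⇒leaf t v∈t x∈v))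

  ∉-monomials : ∀ {G y} (t : ReadOnceSkew G) → just y ∉ leafLabels G → ∀ {w} → w ∈ monomials t → y ∉ w
  ∉-monomials t y∉G w∈ y∈w = y∉G (∈-monomials⇒leaf t w∈ y∈w)

  uniqueListWith⇒leaf : ∀ {G x} (t : ReadOnceSkew G) → UniqueListWith x (monomials t) → just x ∈ leafLabels G
  uniqueListWith⇒leaf t (_ , (w∈ , x∈w) , _) = ∈-monomials⇒leaf t w∈ x∈w

  monomial≢[] : ∀ {G} (t : ReadOnceSkew G) {w} → w ∈ monomials t → w ≢ []
  monomial≢[] (var x) (here ≡.refl) ()
  monomial≢[] (add _ _ s t _) w∈ with ∈-++⁻ (monomials s) w∈
  ... | inj₁ w∈s = monomial≢[] s w∈s
  ... | inj₂ w∈t = monomial≢[] t w∈t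
  monomial≢[] (mul-var y _ _ s _) w∈ with ∈-map⁻ (_∷ʳ y) w∈
  ... | u , _ , ≡.refl = ∷ʳ≢[] u y
  monomial≢[] (var-mul y _ _ t _ _) w∈ with ∈-map⁻ (y ∷_) w∈
  ... | _ , _ , ≡.refl = λ ()

  monomials-disjoint : ∀ {f g} (s : ReadOnceSkew f) (t : ReadOnceSkew g) →
                       Disjoint (leafLabels f) (leafLabels g) → Disjoint (monomials s) (monomials t)
  monomials-disjoint s t f#g {[]}    (w∈s , _)   = monomial≢[] s w∈s ≡.refl
  monomials-disjoint s t f#g {x ∷ w} (w∈s , w∈t) =
    f#g (∈-monomials⇒leaf s w∈s (here ≡.refl) , ∈-monomials⇒leaf t w∈t (here ≡.refl))

  ⟦⟧-isSupport : ∀ {G} (t : ReadOnceSkew G) → IsSupport ⟦ G ⟧ (monomials t)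
  ⟦⟧-isSupport (var x) = isSupport-monoP (x ∷ [])
  ⟦⟧-isSupport (add {a} {f} {b} {g} a≉0 b≉0 s t f#g) =
    isSupport-resp (λ w → sym (⟦add₂⟧ a f b g w))
      (isSupport-+P (monomials-disjoint s t f#g) (isSupport-scaleP a≉0 (⟦⟧-isSupport s)) (isSupport-scaleP b≉0 (⟦⟧-isSupport t)))
  ⟦⟧-isSupport (mul-var {a} {f} {b} y a≉0 b≉0 s _) =
    isSupport-resp (λ w → sym (⟦mul₂⟧ a f b (var y) w))
      (isSupport-scaleP a≉0 (isSupport-scaleP b≉0 (isSupport-*P-var y (⟦⟧-isSupport s))))
  ⟦⟧-isSupport (var-mul {a} {b} {g} y a≉0 b≉0 t _ _) =
    isSupport-resp (λ w → sym (⟦mul₂⟧ a (var y) b g w))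
      (isSupport-scaleP a≉0 (isSupport-scaleP b≉0 (isSupport-var-*P y (⟦⟧-isSupport t))))

  monomial-unique : ∀ {G} (t : ReadOnceSkew G) {w} → w ∈ monomials t → Unique w
  monomial-unique (var x) (here ≡.refl) = [] ∷ []
  monomial-unique (add _ _ s t _) w∈ with ∈-++⁻ (monomials s) w∈
  ... | inj₁ w∈s = monomial-unique s w∈s
  ... | inj₂ w∈t = monomial-unique t w∈t
  monomial-unique (mul-var y _ _ s y∉f) w∈ with ∈-map⁻ (_∷ʳ y) w∈
  ... | u , u∈s , ≡.refl =
    Unique.++⁺ (monomial-unique s u∈s) ([] ∷ []) λ { (y∈u , here ≡.refl) → ∉-monomials s y∉f u∈s y∈u }
  monomial-unique (var-mul y _ _ t _ y∉g) w∈ with ∈-map⁻ (y ∷_) w∈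
  ... | v , v∈t , ≡.refl =
    tabulate (λ z∈v → λ { ≡.refl → ∉-monomials t y∉g v∈t z∈v }) ∷ monomial-unique t v∈t

  length-monomials : ∀ {G} (t : ReadOnceSkew G) → length (monomials t) ≤ 2 ^ sumDepth G
  length-monomials (var x) = ≤-refl
  length-monomials (add {f = f} {g = g} _ _ s t _)
    rewrite length-++ (monomials s) {monomials t} | ⊔-identityʳ (sumDepth g) =
    ≤-trans (+-mono-≤ (length-monomials s) (length-monomials t)) (2^m+2^n≤2^[1+m⊔n] (sumDepth f) (sumDepth g))
  length-monomials (mul-var {f = f} y _ _ s _) rewrite ⊔-identityʳ (sumDepth f) =
    ≤-trans (≤-reflexive (length-map (_∷ʳ y) (monomials s))) (length-monomials s)
  length-monomials (var-mul {g = g} y _ _ t _ _) rewrite ⊔-identityʳ (sumDepth g) =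
    ≤-trans (≤-reflexive (length-map (y ∷_) (monomials t))) (length-monomials t)

  specialVar-uniqueListWith : ∀ {G x} (t : ReadOnceSkew G) → SpecialVar G x → UniqueListWith x (monomials t)
  specialVar-uniqueListWith (add _ _ s t f#g) (in-add (here ≡.refl) sv) =
    let only = specialVar-uniqueListWith s sv in
    uniqueListWith-++ˡ only (∉-monomials t λ x∈g → f#g (uniqueListWith⇒leaf s only , x∈g))
  specialVar-uniqueListWith (add _ _ s t f#g) (in-add (there (here ≡.refl)) sv) =
    let only = specialVar-uniqueListWith t sv in
    uniqueListWith-++ʳ only (∉-monomials s λ x∈f → f#g (x∈f , uniqueListWith⇒leaf t only))
  specialVar-uniqueListWith (add _ _ (var x) t f#g) (plus-leaf (here ≡.refl)) =
    uniqueListWith-++ˡ (uniqueListWith-singleton (here ≡.refl)) (∉-monomials t λ x∈g → f#g (here ≡.refl , x∈g))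
  specialVar-uniqueListWith (add _ _ s (var x) f#g) (plus-leaf (there (here ≡.refl))) =
    uniqueListWith-++ʳ (uniqueListWith-singleton (here ≡.refl)) (∉-monomials s λ x∈f → f#g (x∈f , here ≡.refl))
  specialVar-uniqueListWith (mul-var y _ _ s y∉f) (in-mul {x = x} (here ≡.refl) sv) =
    let only = specialVar-uniqueListWith s sv in
    uniqueListWith-map (_∷ʳ y) ∈-++⁺ˡ (∈-∷ʳ⁻ only) only
    where
    ∈-∷ʳ⁻ : UniqueListWith x (monomials s) → ∀ {u} → u ∈ monomials s → x ∈ u ∷ʳ y → x ∈ u
    ∈-∷ʳ⁻ only {u} _ x∈u∷ʳy with ∈-++⁻ u x∈u∷ʳy
    ... | inj₁ x∈u          = x∈u
    ... | inj₂ (here ≡.refl) = contradiction (uniqueListWith⇒leaf s only) y∉f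
  specialVar-uniqueListWith (mul-var _ _ _ _ _) (in-mul (there (here ≡.refl)) ())
  specialVar-uniqueListWith (mul-var _ _ _ (var x) _) (times-leaf (here ≡.refl) _) =
    uniqueListWith-singleton (here ≡.refl)
  specialVar-uniqueListWith (mul-var _ _ _ (var z) _) (times-leaf (there (here ≡.refl)) (var-leaf z ∷ _)) =
    uniqueListWith-singleton (there (here ≡.refl))
  specialVar-uniqueListWith (var-mul y _ _ t _ y∉g) (in-mul {x = x} (there (here ≡.refl)) sv) =
    let only = specialVar-uniqueListWith t sv in
    uniqueListWith-map (y ∷_) there (∈-∷⁻ only) only
    where
    ∈-∷⁻ : UniqueListWith x (monomials t) → ∀ {u} → u ∈ monomials t → x ∈ y ∷ u → x ∈ u
    ∈-∷⁻ only _ (here ≡.refl) = contradiction (uniqueListWith⇒leaf t only) y∉g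
    ∈-∷⁻ only _ (there x∈u)   = x∈u
  specialVar-uniqueListWith (var-mul _ _ _ _ _ _) (in-mul (here ≡.refl) ())
  specialVar-uniqueListWith (var-mul _ _ _ _ g∉leaf _) (times-leaf _ (_ ∷ g-leaf ∷ [])) =
    contradiction g-leaf g∉leaf

lemma3p1 : ∀ {c ℓ} (F : Field c ℓ) → let open FormulaDefs F in
    (G : Formula) (δ : ℕ) →
    NonZeroWeights G → Skew G → FanIn2 G → sumDepth G ≡ δ →
    All Is-just (leafLabels G) → Unique (leafLabels G) →
    -- multilinear
    (∀ w → Occurs ⟦ G ⟧ w → Unique w)
    -- at most 2^δ monomials
    × (Σ (List Monomial) λ L → length L ≤ 2 ^ δ × (∀ w → Occurs ⟦ G ⟧ w → w ∈ L))
    -- special variables occur in exactly one monomial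
    × (∀ x → SpecialVar G x →
         Σ Monomial λ w → Occurs ⟦ G ⟧ w × x ∈ w
           × (∀ w′ → Occurs ⟦ G ⟧ w′ → x ∈ w′ → w′ ≡ w))
lemma3p1 F G δ nonZero skew fanIn2 ≡.refl variables distinct =
    (λ w → monomial-unique t ∘ occurs⇒∈)
  , (monomials t , length-monomials t , λ w → occurs⇒∈)
  , special
  where
  open ReadOnceSkewFormulas F
  open FormulaDefs F
  t : ReadOnceSkew G
  t = readOnceSkew nonZero skew fanIn2 variables distinct
  open PolynomialProperties.IsSupport (⟦⟧-isSupport t)

  special : ∀ x → SpecialVar G x →
            Σ Monomial λ w → Occurs ⟦ G ⟧ w × x ∈ w × (∀ w′ → Occurs ⟦ G ⟧ w′ → x ∈ w′ → w′ ≡ w)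
  special x sv with specialVar-uniqueListWith t sv
  ... | w , (w∈ , x∈w) , only = w , inside w∈ , x∈w , λ w′ occ x∈w′ → ≡.sym (only (occurs⇒∈ occ , x∈w′))
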